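{- Let $\phi$ be a clause set of set-valued first-order logic. If no blatantly inconsistent clause can be derived from $\phi$ using the rule $(SR)$ (i.e. $\phi$ is consistent), then no blatantly inconsistent clause can be derived from $\phi$ using the rule $(lSR)$.
   Context: Fix a finite set $N$ of agents and a finite set $W$. Terms are many-sorted with one sort per agent, built from sorted variables and sorted function symbols (with given sort profiles). A literal is $A(\bar t)$ with $A\subseteq W$ and $\bar t$ an $N$-tuple of terms whose $j$-th component has sort $j$. A clause is a finite set of literals (read disjunctively), normalized so that each tuple of terms occurs in at most one literal ($A(\bar t),B(\bar t)$ is identified with $(A\cup B)(\bar t)$); a clause set is a finite set of clauses. Equality and unification of tuples is componentwise. The resolution rule $(SR)$: from clauses $\Gamma, A_1(\bar t_1),\dots,A_n(\bar t_n)$ and $B(\bar u),\Delta$ ($n\ge1$), with variables of the two premises renamed apart, derive $\Gamma\sigma, ((\bigcup_{i=1}^nA_i)\cap B)(\bar u\sigma),\Delta\sigma$, where $\sigma$ is the most general unifier of $\bar t_1,\dots,\bar t_n,\bar u$. The rule $(lSR)$ is the same except that $\sigma$ is only required to be some unifier of $\bar t_1,\dots,\bar t_n,\bar u$. A clause is blatantly inconsistent if all its literals have the form $\emptyset(\bar t)$. -}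

module Defs where

open import Data.Nat using (ℕ)
open import Data.Fin using (Fin)
open import Data.Fin.Subset using (Subset; _∪_; _∩_; _∈_) renaming (⊥ to ∅)
open import Data.List using (List; []; _∷_; _++_; map; foldr)
open import Data.List.Relation.Unary.All using (All)
open import Data.List.Relation.Unary.Any using (Any)
open import Data.List.Relation.Unary.AllPairs using (AllPairs)
open import Data.List.Membership.Propositional using () renaming (_∈_ to _∈L_)
open import Data.List.Relation.Binary.Permutation.Propositional using (_↭_)
open import Data.Product using (Σ; ∃; _×_; _,_; proj₁; proj₂)
open import Function.Bundles using (_⇔_)
open import Relation.Nullary using (¬_)
open import Relation.Binary.PropositionalEquality using (_≡_)

-- A many-sorted signature over the agents Fin k (one sort per agent):
-- function symbols with sort profiles  dom f → cod f.
record Signature (k : ℕ) : Set₁ where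
  field
    Fun : Set
    dom : Fun → List (Fin k)
    cod : Fun → Fin k

data Rule : Set where
  SR lSR : Rule

-- k = number of agents (N = Fin k), m = |W| (W = Fin m).
module Logic (k m : ℕ) (S : Signature k) where
  open Signature S

  Sort : Set
  Sort = Fin k

  mutual
    data Term : Sort → Set where
      var : ∀ {s} → ℕ → Term s
      app : (f : Fun) → Args (dom f) → Term (cod f)

    data Args : List Sort → Set where
      []  : Args []
      _∷_ : ∀ {s ss} → Term s → Args ss → Args (s ∷ ss)

  Subst : Set
  Subst = (s : Sort) → ℕ → Term s

  mutual
    _[_]t : ∀ {s} → Term s → Subst → Term s
    var {s} x [ σ ]t = σ s x
    app f as  [ σ ]t = app f (as [ σ ]a)

    _[_]a : ∀ {ss} → Args ss → Subst → Args ss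
    []       [ σ ]a = []
    (t ∷ ts) [ σ ]a = (t [ σ ]t) ∷ (ts [ σ ]a)

  Tuple : Set
  Tuple = (j : Sort) → Term j

  _≈T_ : Tuple → Tuple → Set
  t ≈T u = ∀ j → t j ≡ u j

  _[_]T : Tuple → Subst → Tuple
  (t [ σ ]T) j = t j [ σ ]t

  Literal : Set
  Literal = Subset m × Tuple

  _[_]L : Literal → Subst → Literal
  (A , t) [ σ ]L = A , (t [ σ ]T)

  -- clause: finite list of literals (read disjunctively)
  Clause : Set
  Clause = List Literal

  _[_]C : Clause → Subst → Clause
  C [ σ ]C = map (_[ σ ]L) C

  Normal : Clause → Set
  Normal = AllPairs (λ l l' → ¬ (proj₂ l ≈T proj₂ l'))

  -- D is the normalization of the raw list of literals L
  -- (literals with equal tuples merged by union of their sets)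
  Normalizes : Clause → Clause → Set
  Normalizes D L =
      Normal D
    × All (λ l → Any (λ l' → proj₂ l ≈T proj₂ l') D) L
    × All (λ l → Any (λ l' → proj₂ l' ≈T proj₂ l) L
               × (∀ (w : Fin m) → (w ∈ proj₁ l) ⇔
                    Any (λ l' → (proj₂ l' ≈T proj₂ l) × (w ∈ proj₁ l')) L)) D

  mutual
    data OccT (s : Sort) (x : ℕ) : ∀ {s'} → Term s' → Set where
      here : OccT s x (var {s} x)
      inArgs : ∀ {f} {as : Args (dom f)} → OccA s x as → OccT s x (app f as)

    data OccA (s : Sort) (x : ℕ) : ∀ {ss} → Args ss → Set where
      hd : ∀ {s' ss} {t : Term s'} {ts : Args ss} → OccT s x t → OccA s x (t ∷ ts)
      tl : ∀ {s' ss} {t : Term s'} {ts : Args ss} → OccA s x ts → OccA s x (t ∷ ts)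

  OccC : Sort → ℕ → Clause → Set
  OccC s x C = Any (λ l → ∃ λ j → OccT s x (proj₂ l j)) C

  Apart : Clause → Clause → Set
  Apart C D = ∀ s x → OccC s x C → ¬ OccC s x D

  Renaming : Set
  Renaming = Sort → ℕ → ℕ

  Injective : Renaming → Set
  Injective ρ = ∀ s x y → ρ s x ≡ ρ s y → x ≡ y

  ren : Renaming → Subst
  ren ρ s x = var (ρ s x)

  Unifies : Subst → List Tuple → Tuple → Set
  Unifies σ ts u = All (λ t → (t [ σ ]T) ≈T (u [ σ ]T)) ts

  MGU : Subst → List Tuple → Tuple → Set
  MGU σ ts u = Unifies σ ts u
             × (∀ τ → Unifies τ ts u →
                  ∃ λ (θ : Subst) → ∀ s x → τ s x ≡ (σ s x [ θ ]t))

  UnifierFor : Rule → Subst → List Tuple → Tuple → Set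
  UnifierFor SR  = MGU
  UnifierFor lSR = Unifies

  ⋃ : List Literal → Subset m
  ⋃ As = foldr _∪_ ∅ (map proj₁ As)

  data Derives (r : Rule) (φ : List Clause) : Clause → Set where
    axiom : ∀ {C} → C ∈L φ → Derives r φ C
    step  : ∀ {C₁ C₂} (ρ₁ ρ₂ : Renaming) (Γ As : List Literal) (B : Subset m)
              (u : Tuple) (Δ : List Literal) (σ : Subst) (D : Clause) →
            Derives r φ C₁ → Derives r φ C₂ →
            Injective ρ₁ → Injective ρ₂ →
            Apart (C₁ [ ren ρ₁ ]C) (C₂ [ ren ρ₂ ]C) →
            (C₁ [ ren ρ₁ ]C) ↭ (Γ ++ As) →
            ¬ (As ≡ []) →
            (C₂ [ ren ρ₂ ]C) ↭ ((B , u) ∷ Δ) →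
            UnifierFor r σ (map proj₂ As) u →
            Normalizes D ((Γ [ σ ]C) ++ (((⋃ As ∩ B) , (u [ σ ]T)) ∷ (Δ [ σ ]C))) →
            Derives r φ D

  BlatantlyInconsistent : Clause → Set
  BlatantlyInconsistent C = All (λ l → proj₁ l ≡ ∅) C

  Consistent : Rule → List Clause → Set
  Consistent r φ = ¬ (∃ λ C → Derives r φ C × BlatantlyInconsistent C)

-- Every (lSR) derivation is lifted to an (SR) derivation: for each clause D′ derivable with (lSR)
-- there are a clause D derivable with (SR) and a substitution θ such that every literal A(t̄) of D
-- lies under a literal B(t̄θ) of D′ with A ⊆ B, so a blatantly inconsistent D′ forces D to be
-- blatantly inconsistent.  In an (lSR) step, the literals of the lifted first premise that land on
-- the resolved literals play the role of A₁(t̄₁),…,Aₙ(t̄ₙ) in an (SR) step; as some unifier exists, a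
-- most general one exists too, and the lifting substitution factors through it.  The lifted second
-- premise may have several literals landing on B(ū); they are resolved away one at a time, and
-- normalization never increases their number because the literals of a normal clause have distinct
-- tuples.  Equality of tuples is not decidable, so the construction runs in the double-negation
-- monad, which suffices for the negative statement of consistency.
module Submission where

open import Defs
open import Data.Nat using (ℕ; zero; suc; _+_; _≤_; _<_; s≤s; z≤n)
open import Data.Nat.Properties
  using ( ≤-refl; ≤-trans; ≤-reflexive; ≤-pred; <-≤-trans; <-irrefl; m≤m+n; m≤n+m; n≤1+n
        ; +-monoˡ-≤; +-monoʳ-≤; +-assoc; module ≤-Reasoning)
import Data.Nat.Properties as ℕ
open import Algebra.Properties.CommutativeSemigroup ℕ.+-commutativeSemigroup using (interchange)
open import Data.Fin using (Fin)
import Data.Fin.Properties as Fin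
open import Data.Maybe using (Maybe; just; nothing)
open import Data.Maybe.Properties using (just-injective)
open import Data.List using (List; []; _∷_; _++_; map; length; allFin)
open import Data.List.Properties using (length-removeAt′; map-++; length-map; ++-assoc)
open import Data.List.Relation.Unary.All as All using (All; []; _∷_)
open import Data.List.Relation.Unary.Any as Any using (Any; here; there; _─_)
open import Data.List.Relation.Unary.AllPairs using (AllPairs; []; _∷_)
open import Data.List.Relation.Binary.Sublist.Propositional using (_⊆_; []; _∷_; _∷ʳ_)
open import Data.List.Relation.Binary.Sublist.Propositional.Properties using (All-resp-⊆)
open import Data.List.Relation.Binary.Permutation.Propositional
  using (_↭_; prep; ↭-refl; ↭-trans; ↭-sym; ↭-reflexive)
open import Data.List.Relation.Binary.Permutation.Propositional.Properties as Permₚ using (shift)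
open import Data.List.Membership.Propositional using (_∈_; lose; find)
open import Data.List.Membership.Propositional.Properties using (∈-allFin; ∈-++⁺ʳ; ∈-map⁺)
open import Data.List.Relation.Unary.All.Properties as Allₚ using (All¬⇒¬Any; ¬Any⇒All¬)
open import Data.Product using (Σ; ∃; ∃₂; _×_; _,_; proj₁; proj₂)
open import Data.Sum using (_⊎_; inj₁; inj₂; [_,_]′)
import Data.Sum as Sum
open import Data.Sum.Properties using (inj₁-injective; inj₂-injective)
open import Data.Empty using (⊥-elim)
open import Function using (_∋_; _∘_; case_of_)
open import Function.Bundles using (_⇔_; mk⇔; Equivalence)
open import Data.Fin.Subset using (Subset; _∪_; _∩_) renaming (_∈_ to _∈ₛ_; _⊆_ to _⊆ₛ_; ⊥ to ∅)
open import Data.Fin.Subset.Properties using (x∈p∪q⁻; x∈p∪q⁺; x∈p∩q⁻; x∈p∩q⁺; ⊆-antisym; ⊥⊆; ∉⊥)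
open import Relation.Nullary.Negation using (¬¬-Monad; DoubleNegation)
open import Relation.Nullary.Decidable using (Dec; ¬¬-excluded-middle)
open import Effect.Monad using (RawMonad)
open import Level using (Level)
open import Relation.Binary.Bundles using (Setoid)
open import Relation.Nullary using (¬_; yes; no)
import Data.List.Relation.Unary.AllPairs.Properties as AllPairsₚ
import Data.List.Relation.Unary.Any.Properties as Anyₚ
open import Relation.Binary.PropositionalEquality
  using (_≡_; refl; sym; trans; cong; cong₂; subst; module ≡-Reasoning)

open RawMonad (¬¬-Monad {a = Level.zero}) using (_>>=_; pure)

Any-─⁺ : ∀ {a p q} {A : Set a} {P : A → Set p} {Q : A → Set q} {ys : List A} (i : Any P ys) → Any Q ys →
         (∀ {y} → P y → ¬ Q y) → Any Q (ys ─ i)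
Any-─⁺ (here p)  (here q)  disjoint = ⊥-elim (disjoint p q)
Any-─⁺ (here p)  (there j) _        = j
Any-─⁺ (there i) (here q)  _        = here q
Any-─⁺ (there i) (there j) disjoint = there (Any-─⁺ i j disjoint)

AllPairs-resp-⊇ : ∀ {A : Set} {R : A → A → Set} {xs ys : List A} → xs ⊆ ys → AllPairs R ys → AllPairs R xs
AllPairs-resp-⊇ []         []       = []
AllPairs-resp-⊇ (_ ∷ʳ p)   (_ ∷ rs) = AllPairs-resp-⊇ p rs
AllPairs-resp-⊇ (refl ∷ p) (r ∷ rs) = All-resp-⊆ p r ∷ AllPairs-resp-⊇ p rs

¬¬-decide-all : ∀ {A : Set} (P : A → Set) (xs : List A) → DoubleNegation (All (λ x → Dec (P x)) xs)
¬¬-decide-all P xs = All.sequenceM _ ¬¬-Monad (All.universal (λ _ → ¬¬-excluded-middle) xs)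

map≡[]⇒≡[] : ∀ {A B : Set} {f : A → B} (xs : List A) → map f xs ≡ [] → xs ≡ []
map≡[]⇒≡[] []      _  = refl
map≡[]⇒≡[] (_ ∷ _) ()

double : ℕ → ℕ
double zero    = zero
double (suc x) = suc (suc (double x))

encode : ℕ ⊎ ℕ → ℕ
encode (inj₁ x) = double x
encode (inj₂ x) = suc (double x)

decode : ℕ → ℕ ⊎ ℕ
decode zero          = inj₁ zero
decode (suc zero)    = inj₂ zero
decode (suc (suc n)) = Sum.map suc suc (decode n)

decode-encode : ∀ v → decode (encode v) ≡ v
decode-encode (inj₁ zero)    = refl
decode-encode (inj₁ (suc x)) = cong (Sum.map suc suc) (decode-encode (inj₁ x))
decode-encode (inj₂ zero)    = refl
decode-encode (inj₂ (suc x)) = cong (Sum.map suc suc) (decode-encode (inj₂ x))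

encode-injective : ∀ {v w} → encode v ≡ encode w → v ≡ w
encode-injective {v} {w} eq = trans (sym (decode-encode v)) (trans (cong decode eq) (decode-encode w))

record Split {A : Set} (P Q : A → Set) (xs : List A) : Set where
  field
    left right : List A
    ↭-split    : xs ↭ left ++ right
    all-left   : All P left
    all-right  : All Q right
    right-⊆    : right ⊆ xs

split : ∀ {A : Set} {P Q : A → Set} {xs : List A} → All (λ x → P x ⊎ Q x) xs → Split P Q xs
split [] = record
  { left = [] ; right = [] ; ↭-split = ↭-refl ; all-left = [] ; all-right = [] ; right-⊆ = [] }
split {xs = x ∷ _} (inj₁ p ∷ pqs) = record
  { left = x ∷ left ; right = right ; ↭-split = prep x ↭-split
  ; all-left = p ∷ all-left ; all-right = all-right ; right-⊆ = x ∷ʳ right-⊆ }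
  where open Split (split pqs)
split {xs = x ∷ _} (inj₂ q ∷ pqs) = record
  { left = left ; right = x ∷ right
  ; ↭-split = ↭-trans (prep x ↭-split) (↭-sym (shift x left right))
  ; all-left = all-left ; all-right = q ∷ all-right ; right-⊆ = refl ∷ right-⊆ }
  where open Split (split pqs)

module _ {a ℓ : Level} (S : Setoid a ℓ) where
  open Setoid S using (Carrier; _≈_) renaming (sym to ≈-sym; trans to ≈-trans)

  Distinct : List Carrier → Set (a Level.⊔ ℓ)
  Distinct = AllPairs (λ x y → ¬ x ≈ y)

  Distinct-∈-≈⇒≡ : ∀ {xs x y} → Distinct xs → x ∈ xs → y ∈ xs → x ≈ y → x ≡ y
  Distinct-∈-≈⇒≡ (_   ∷ _)  (here refl) (here refl) _   = refl
  Distinct-∈-≈⇒≡ (x≉ ∷ _)  (here refl) (there y∈) x≈y = ⊥-elim (All¬⇒¬Any x≉ (lose y∈ x≈y))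
  Distinct-∈-≈⇒≡ (y≉ ∷ _)  (there x∈) (here refl) x≈y = ⊥-elim (All¬⇒¬Any y≉ (lose x∈ (≈-sym x≈y)))
  Distinct-∈-≈⇒≡ (_   ∷ ds) (there x∈) (there y∈) x≈y = Distinct-∈-≈⇒≡ ds x∈ y∈ x≈y

  Distinct-length-≤ : ∀ {xs ys} → Distinct xs → All (λ x → Any (_≈ x) ys) xs → length xs ≤ length ys
  Distinct-length-≤ [] [] = z≤n
  Distinct-length-≤ {ys = ys} (x≉ ∷ ds) (x∈ys ∷ xs∈ys) =
    ≤-trans (s≤s (Distinct-length-≤ ds (All.zipWith still-covered (x≉ , xs∈ys))))
            (≤-reflexive (sym (length-removeAt′ ys (Any.index x∈ys))))
    where
    still-covered : ∀ {z} → (¬ _ ≈ z) × Any (_≈ z) ys → Any (_≈ z) (ys ─ x∈ys)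
    still-covered (x≉z , z∈ys) = Any-─⁺ x∈ys z∈ys (λ y≈x y≈z → x≉z (≈-trans (≈-sym y≈x) y≈z))

module Resolution (k m : ℕ) (S : Signature k) where
  open Signature S
  open Logic k m S

  -- Substitutions

  idSubst : Subst
  idSubst _ x = var x

  infixl 5 _⨾_
  _⨾_ : Subst → Subst → Subst
  (σ ⨾ θ) s x = σ s x [ θ ]t

  infix 4 _≗ₛ_
  _≗ₛ_ : Subst → Subst → Set
  σ ≗ₛ θ = ∀ s x → σ s x ≡ θ s x

  mutual
    []t-cong : ∀ {σ θ} → σ ≗ₛ θ → ∀ {s} (t : Term s) → t [ σ ]t ≡ t [ θ ]t
    []t-cong σ≗θ (var {s} x) = σ≗θ s x
    []t-cong σ≗θ (app f as)  = cong (app f) ([]a-cong σ≗θ as)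

    []a-cong : ∀ {σ θ} → σ ≗ₛ θ → ∀ {ss} (as : Args ss) → as [ σ ]a ≡ as [ θ ]a
    []a-cong σ≗θ []       = refl
    []a-cong σ≗θ (t ∷ as) = cong₂ _∷_ ([]t-cong σ≗θ t) ([]a-cong σ≗θ as)

  mutual
    []t-⨾ : ∀ σ θ {s} (t : Term s) → (t [ σ ]t) [ θ ]t ≡ t [ σ ⨾ θ ]t
    []t-⨾ σ θ (var x)    = refl
    []t-⨾ σ θ (app f as) = cong (app f) ([]a-⨾ σ θ as)

    []a-⨾ : ∀ σ θ {ss} (as : Args ss) → (as [ σ ]a) [ θ ]a ≡ as [ σ ⨾ θ ]a
    []a-⨾ σ θ []       = refl
    []a-⨾ σ θ (t ∷ as) = cong₂ _∷_ ([]t-⨾ σ θ t) ([]a-⨾ σ θ as)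

  mutual
    []t-id : ∀ {s} (t : Term s) → t [ idSubst ]t ≡ t
    []t-id (var x)    = refl
    []t-id (app f as) = cong (app f) ([]a-id as)

    []a-id : ∀ {ss} (as : Args ss) → as [ idSubst ]a ≡ as
    []a-id []       = refl
    []a-id (t ∷ as) = cong₂ _∷_ ([]t-id t) ([]a-id as)

  -- Unification

  SortedTerm : Set
  SortedTerm = Σ Sort Term

  _⟨_⟩ : SortedTerm → Subst → SortedTerm
  (s , t) ⟨ σ ⟩ = s , t [ σ ]t

  ⟨⟩-absorb : ∀ {σ τ} → τ ≗ₛ σ ⨾ τ → ∀ a → (a ⟨ σ ⟩) ⟨ τ ⟩ ≡ a ⟨ τ ⟩
  ⟨⟩-absorb {σ} {τ} τ≗σ⨾τ (s , t) = cong (s ,_) (trans ([]t-⨾ σ τ t) (sym ([]t-cong τ≗σ⨾τ t)))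

  Equation : Set
  Equation = SortedTerm × SortedTerm

  Solves : Subst → List Equation → Set
  Solves σ = All (λ e → proj₁ e ⟨ σ ⟩ ≡ proj₂ e ⟨ σ ⟩)

  -- The idempotent form of most generality: in MGU the witness can be taken to be τ itself.
  MostGeneral : Subst → List Equation → Set
  MostGeneral σ E = Solves σ E × (∀ τ → Solves τ E → τ ≗ₛ σ ⨾ τ)

  MGUOf : List Equation → Set
  MGUOf E = ∃ λ σ → MostGeneral σ E

  _⟪_⟫ : List Equation → Subst → List Equation
  E ⟪ σ ⟫ = map (λ e → proj₁ e ⟨ σ ⟩ , proj₂ e ⟨ σ ⟩) E

  Solves-⟪⟫⁺ : ∀ {σ τ} → τ ≗ₛ σ ⨾ τ → ∀ E → Solves τ E → Solves τ (E ⟪ σ ⟫)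
  Solves-⟪⟫⁺ τ≗σ⨾τ []            []       = []
  Solves-⟪⟫⁺ τ≗σ⨾τ ((a , b) ∷ E) (e ∷ es) =
    trans (⟨⟩-absorb τ≗σ⨾τ a) (trans e (sym (⟨⟩-absorb τ≗σ⨾τ b))) ∷ Solves-⟪⟫⁺ τ≗σ⨾τ E es

  Solves-⟪⟫⁻ : ∀ σ θ E → Solves θ (E ⟪ σ ⟫) → Solves (σ ⨾ θ) E
  Solves-⟪⟫⁻ σ θ []                        []       = []
  Solves-⟪⟫⁻ σ θ (((s , a) , (s′ , b)) ∷ E) (e ∷ es) =
    trans (cong (s ,_) (sym ([]t-⨾ σ θ a))) (trans e (cong (s′ ,_) ([]t-⨾ σ θ b)))
    ∷ Solves-⟪⟫⁻ σ θ E es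

  mutual
    size : ∀ {s} → Term s → ℕ
    size (var x)    = 1
    size (app f as) = suc (sizeᵃ as)

    sizeᵃ : ∀ {ss} → Args ss → ℕ
    sizeᵃ []       = 0
    sizeᵃ (t ∷ as) = size t + sizeᵃ as

  size-pos : ∀ {s} (t : Term s) → 1 ≤ size t
  size-pos (var x)    = s≤s z≤n
  size-pos (app f as) = s≤s z≤n

  ‖_‖ : SortedTerm → ℕ
  ‖ _ , t ‖ = size t

  weight : Subst → List Equation → ℕ
  weight τ []            = 0
  weight τ ((a , b) ∷ E) = ‖ a ⟨ τ ⟩ ‖ + ‖ b ⟨ τ ⟩ ‖ + weight τ E

  weight-++ : ∀ τ E F → weight τ (E ++ F) ≡ weight τ E + weight τ F
  weight-++ τ []            F = refl
  weight-++ τ ((a , b) ∷ E) F =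
    trans (cong (‖ a ⟨ τ ⟩ ‖ + ‖ b ⟨ τ ⟩ ‖ +_) (weight-++ τ E F))
          (sym (+-assoc (‖ a ⟨ τ ⟩ ‖ + ‖ b ⟨ τ ⟩ ‖) (weight τ E) (weight τ F)))

  weight-⟪⟫ : ∀ {σ τ} → τ ≗ₛ σ ⨾ τ → ∀ E → weight τ (E ⟪ σ ⟫) ≡ weight τ E
  weight-⟪⟫ τ≗σ⨾τ []            = refl
  weight-⟪⟫ τ≗σ⨾τ ((a , b) ∷ E) =
    cong₂ _+_ (cong₂ _+_ (cong ‖_‖ (⟨⟩-absorb τ≗σ⨾τ a)) (cong ‖_‖ (⟨⟩-absorb τ≗σ⨾τ b))) (weight-⟪⟫ τ≗σ⨾τ E)

  weight-∷ : ∀ τ a b E → weight τ E < weight τ ((a , b) ∷ E)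
  weight-∷ τ a b E = +-monoˡ-≤ (weight τ E) (≤-trans (size-pos (proj₂ a [ τ ]t)) (m≤m+n _ _))

  term-≡ : ∀ {s} {t u : Term s} → (SortedTerm ∋ (s , t)) ≡ (s , u) → t ≡ u
  term-≡ refl = refl

  args-≡ : ∀ {f} {as bs : Args (dom f)} → (SortedTerm ∋ (cod f , app f as)) ≡ (cod f , app f bs) → as ≡ bs
  args-≡ refl = refl

  ∷-injectiveᵃ : ∀ {s ss} {a b : Term s} {as bs : Args ss} →
                 (Args (s ∷ ss) ∋ a ∷ as) ≡ b ∷ bs → a ≡ b × as ≡ bs
  ∷-injectiveᵃ refl = refl , refl

  head : SortedTerm → Maybe Fun
  head (_ , var _)   = nothing
  head (_ , app f _) = just f

  mutual
    occurs⇒size≤ : ∀ τ {s x s'} {u : Term s'} → OccT s x u → size (τ s x) ≤ size (u [ τ ]t)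
    occurs⇒size≤ τ here       = ≤-refl
    occurs⇒size≤ τ (inArgs o) = ≤-trans (occursᵃ⇒size≤ τ o) (n≤1+n _)

    occursᵃ⇒size≤ : ∀ τ {s x ss} {as : Args ss} → OccA s x as → size (τ s x) ≤ sizeᵃ (as [ τ ]a)
    occursᵃ⇒size≤ τ (hd o) = ≤-trans (occurs⇒size≤ τ o) (m≤m+n _ _)
    occursᵃ⇒size≤ τ (tl o) = ≤-trans (occursᵃ⇒size≤ τ o) (m≤n+m _ _)

  infix 6 _↦_
  _↦_ : ∀ {s} → ℕ → Term s → Subst
  (_↦_ {s} x t) s' y with s' Fin.≟ s | y ℕ.≟ x
  ... | yes refl | yes _ = t
  ... | _        | _     = var y

  ↦-self : ∀ {s} x (t : Term s) → (x ↦ t) s x ≡ t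
  ↦-self {s} x t with s Fin.≟ s | x ℕ.≟ x
  ... | yes refl | yes _   = refl
  ... | yes refl | no x≢x  = ⊥-elim (x≢x refl)
  ... | no s≢s   | _       = ⊥-elim (s≢s refl)

  ↦-absorb : ∀ {s} x (t : Term s) τ → τ s x ≡ t [ τ ]t → τ ≗ₛ (x ↦ t) ⨾ τ
  ↦-absorb {s} x t τ τx≡tτ s' y with s' Fin.≟ s | y ℕ.≟ x
  ... | yes refl | yes refl = τx≡tτ
  ... | yes refl | no _     = refl
  ... | no _     | _        = refl

  mutual
    ↦-fresh : ∀ {s} x (t : Term s) {s'} (u : Term s') → ¬ OccT s x u → u [ x ↦ t ]t ≡ u
    ↦-fresh {s} x t (var {s'} y) x∉u with s' Fin.≟ s | y ℕ.≟ x
    ... | yes refl | yes refl = ⊥-elim (x∉u here)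
    ... | yes refl | no _     = refl
    ... | no _     | _        = refl
    ↦-fresh x t (app f as) x∉u = cong (app f) (↦-freshᵃ x t as (λ o → x∉u (inArgs o)))

    ↦-freshᵃ : ∀ {s} x (t : Term s) {ss} (as : Args ss) → ¬ OccA s x as → as [ x ↦ t ]a ≡ as
    ↦-freshᵃ x t []       _    = refl
    ↦-freshᵃ x t (u ∷ as) x∉as =
      cong₂ _∷_ (↦-fresh x t u (λ o → x∉as (hd o))) (↦-freshᵃ x t as (λ o → x∉as (tl o)))

  pairs : ∀ {ss} → Args ss → Args ss → List Equation
  pairs []       []       = []
  pairs (a ∷ as) (b ∷ bs) = ((_ , a) , (_ , b)) ∷ pairs as bs

  Solves-pairs⁺ : ∀ τ {ss} (as bs : Args ss) → as [ τ ]a ≡ bs [ τ ]a → Solves τ (pairs as bs)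
  Solves-pairs⁺ τ []       []       _  = []
  Solves-pairs⁺ τ (a ∷ as) (b ∷ bs) eq =
    cong (_ ,_) (proj₁ (∷-injectiveᵃ eq)) ∷ Solves-pairs⁺ τ as bs (proj₂ (∷-injectiveᵃ eq))

  Solves-pairs⁻ : ∀ τ {ss} (as bs : Args ss) → Solves τ (pairs as bs) → as [ τ ]a ≡ bs [ τ ]a
  Solves-pairs⁻ τ []       []       []       = refl
  Solves-pairs⁻ τ (a ∷ as) (b ∷ bs) (e ∷ es) = cong₂ _∷_ (term-≡ e) (Solves-pairs⁻ τ as bs es)

  weight-pairs : ∀ τ {ss} (as bs : Args ss) → weight τ (pairs as bs) ≡ sizeᵃ (as [ τ ]a) + sizeᵃ (bs [ τ ]a)
  weight-pairs τ []       []       = refl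
  weight-pairs τ (a ∷ as) (b ∷ bs) =
    trans (cong (size (a [ τ ]t) + size (b [ τ ]t) +_) (weight-pairs τ as bs))
          (interchange (size (a [ τ ]t)) (size (b [ τ ]t)) (sizeᵃ (as [ τ ]a)) (sizeᵃ (bs [ τ ]a)))

  weight-decompose : ∀ τ f (as bs : Args (dom f)) E →
                     weight τ (pairs as bs ++ E) < weight τ (((cod f , app f as) , (cod f , app f bs)) ∷ E)
  weight-decompose τ f as bs E = begin-strict
    weight τ (pairs as bs ++ E)          ≡⟨ weight-++ τ (pairs as bs) E ⟩
    weight τ (pairs as bs) + weight τ E  ≡⟨ cong (_+ weight τ E) (weight-pairs τ as bs) ⟩
    A + B + weight τ E                   <⟨ s≤s (+-monoˡ-≤ (weight τ E) (+-monoʳ-≤ A (n≤1+n B))) ⟩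
    suc A + suc B + weight τ E           ∎
    where
    open ≤-Reasoning
    A = sizeᵃ (as [ τ ]a)
    B = sizeᵃ (bs [ τ ]a)

  MGU-trivial : ∀ a E → MGUOf E → MGUOf ((a , a) ∷ E)
  MGU-trivial a E (σ , σ⊨E , σ-general) = σ , refl ∷ σ⊨E , λ { ρ (_ ∷ ρ⊨E) → σ-general ρ ρ⊨E }

  MGU-swap : ∀ a b E → MGUOf ((b , a) ∷ E) → MGUOf ((a , b) ∷ E)
  MGU-swap a b E (σ , e ∷ σ⊨E , σ-general) = σ , sym e ∷ σ⊨E , λ { ρ (e′ ∷ ρ⊨E) → σ-general ρ (sym e′ ∷ ρ⊨E) }

  MGU-decompose : ∀ f (as bs : Args (dom f)) E → MGUOf (pairs as bs ++ E) →
                  MGUOf (((cod f , app f as) , (cod f , app f bs)) ∷ E)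
  MGU-decompose f as bs E (σ , σ⊨ , σ-general) =
    σ , cong (λ cs → cod f , app f cs) (Solves-pairs⁻ σ as bs (Allₚ.++⁻ˡ (pairs as bs) σ⊨))
        ∷ Allₚ.++⁻ʳ (pairs as bs) σ⊨ ,
    λ { ρ (e ∷ ρ⊨E) → σ-general ρ (Allₚ.++⁺ (Solves-pairs⁺ ρ as bs (args-≡ e)) ρ⊨E) }

  MGU-bind : ∀ {s} x (t : Term s) E → ¬ OccT s x t → MGUOf (E ⟪ x ↦ t ⟫) → MGUOf (((s , var x) , (s , t)) ∷ E)
  MGU-bind {s} x t E x∉t (σ , σ⊨ , σ-general) =
    (x ↦ t) ⨾ σ , solves-binding ∷ Solves-⟪⟫⁻ (x ↦ t) σ E σ⊨ , general
    where
    open ≡-Reasoning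
    solves-binding : (s , (x ↦ t) s x [ σ ]t) ≡ (s , t [ (x ↦ t) ⨾ σ ]t)
    solves-binding = cong (s ,_) (begin
      (x ↦ t) s x [ σ ]t     ≡⟨ cong (_[ σ ]t) (↦-self x t) ⟩
      t [ σ ]t               ≡⟨ cong (_[ σ ]t) (↦-fresh x t t x∉t) ⟨
      (t [ x ↦ t ]t) [ σ ]t  ≡⟨ []t-⨾ (x ↦ t) σ t ⟩
      t [ (x ↦ t) ⨾ σ ]t     ∎)
    general : ∀ ρ → Solves ρ (((s , var x) , (s , t)) ∷ E) → ρ ≗ₛ (x ↦ t) ⨾ σ ⨾ ρ
    general ρ (ρx≡tρ ∷ ρ⊨E) s' y = begin
      ρ s' y                         ≡⟨ absorbs s' y ⟩
      (x ↦ t) s' y [ ρ ]t            ≡⟨ []t-cong (σ-general ρ (Solves-⟪⟫⁺ absorbs E ρ⊨E)) ((x ↦ t) s' y) ⟩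
      (x ↦ t) s' y [ σ ⨾ ρ ]t        ≡⟨ []t-⨾ σ ρ ((x ↦ t) s' y) ⟨
      ((x ↦ t) s' y [ σ ]t) [ ρ ]t   ∎
      where absorbs = ↦-absorb x t ρ (term-≡ ρx≡tρ)

  -- The recursion is on the size of the equations instantiated by a fixed solution τ.  It does not
  -- grow when a binding x ↦ t is applied, since τ ≗ (x ↦ t) ⨾ τ.
  mutual
    unify : ∀ n τ E → Solves τ E → weight τ E < n → MGUOf E
    unify zero    τ E _ ()
    unify (suc n) τ [] _ _ = idSubst , [] , λ _ _ _ _ → refl
    unify (suc n) τ (((s , var x) , (s′ , t)) ∷ E) (e ∷ τ⊨E) w< with cong proj₁ e
    ... | refl = eliminate n τ x t E (term-≡ e) τ⊨E (<-≤-trans (weight-∷ τ (_ , var x) (_ , t) E) (≤-pred w<))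
    unify (suc n) τ (((s , app f as) , (s′ , var y)) ∷ E) (e ∷ τ⊨E) w< with cong proj₁ e
    ... | refl = MGU-swap _ _ E (eliminate n τ y (app f as) E (sym (term-≡ e)) τ⊨E
                                  (<-≤-trans (weight-∷ τ (_ , app f as) (_ , var y) E) (≤-pred w<)))
    unify (suc n) τ (((s , app f as) , (s′ , app g bs)) ∷ E) (e ∷ τ⊨E) w< with just-injective (cong head e)
    ... | refl = MGU-decompose f as bs E
                   (unify n τ (pairs as bs ++ E) (Allₚ.++⁺ (Solves-pairs⁺ τ as bs (args-≡ e)) τ⊨E)
                          (<-≤-trans (weight-decompose τ f as bs E) (≤-pred w<)))

    eliminate : ∀ n τ {s} x (t : Term s) E → τ s x ≡ t [ τ ]t → Solves τ E → weight τ E < n →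
                MGUOf (((s , var x) , (s , t)) ∷ E)
    eliminate n τ x (var y) E τx≡tτ τ⊨E w< with y ℕ.≟ x
    ... | yes refl = MGU-trivial _ E (unify n τ E τ⊨E w<)
    ... | no y≢x   = MGU-bind x (var y) E (λ { here → y≢x refl }) (binding-step n τ x (var y) E τx≡tτ τ⊨E w<)
    eliminate n τ x (app f as) E τx≡tτ τ⊨E w< =
      MGU-bind x (app f as) E occurs-check (binding-step n τ x (app f as) E τx≡tτ τ⊨E w<)
      where
      occurs-check : ¬ OccT _ x (app f as)
      occurs-check (inArgs o) = <-irrefl (cong size τx≡tτ) (s≤s (occursᵃ⇒size≤ τ o))

    binding-step : ∀ n τ {s} x (t : Term s) E → τ s x ≡ t [ τ ]t → Solves τ E → weight τ E < n →
                   MGUOf (E ⟪ x ↦ t ⟫)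
    binding-step n τ x t E τx≡tτ τ⊨E w< =
      unify n τ (E ⟪ x ↦ t ⟫) (Solves-⟪⟫⁺ absorbs E τ⊨E) (subst (_< n) (sym (weight-⟪⟫ absorbs E)) w<)
      where absorbs = ↦-absorb x t τ τx≡tτ

  componentEquations : Tuple → Tuple → List Equation
  componentEquations t u = map (λ j → (j , t j) , (j , u j)) (allFin k)

  tupleEquations : List Tuple → Tuple → List Equation
  tupleEquations []       u = []
  tupleEquations (t ∷ ts) u = componentEquations t u ++ tupleEquations ts u

  Unifies⇒Solves : ∀ {σ} ts u → Unifies σ ts u → Solves σ (tupleEquations ts u)
  Unifies⇒Solves []       u []          = []
  Unifies⇒Solves (t ∷ ts) u (t≈u ∷ ts≈u) =
    Allₚ.++⁺ (Allₚ.map⁺ (All.tabulate (λ {j} _ → cong (j ,_) (t≈u j)))) (Unifies⇒Solves ts u ts≈u)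

  Solves⇒Unifies : ∀ {σ} ts u → Solves σ (tupleEquations ts u) → Unifies σ ts u
  Solves⇒Unifies []       u _ = []
  Solves⇒Unifies (t ∷ ts) u σ⊨ =
    (λ j → term-≡ (All.lookup (Allₚ.map⁻ (Allₚ.++⁻ˡ (componentEquations t u) σ⊨)) (∈-allFin j)))
    ∷ Solves⇒Unifies ts u (Allₚ.++⁻ʳ (componentEquations t u) σ⊨)

  unifiable⇒mgu : ∀ τ ts u → Unifies τ ts u → ∃ λ σ → MGU σ ts u
  unifiable⇒mgu τ ts u τ⊨ =
    let σ , σ⊨E , σ-general = unify (suc (weight τ E)) τ E (Unifies⇒Solves ts u τ⊨) ≤-refl
    in σ , Solves⇒Unifies ts u σ⊨E , λ ρ ρ⊨ → ρ , σ-general ρ (Unifies⇒Solves ts u ρ⊨)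
    where E = tupleEquations ts u

  -- Normalization

  ≈T-refl : ∀ {t} → t ≈T t
  ≈T-refl _ = refl

  ≈T-sym : ∀ {t u} → t ≈T u → u ≈T t
  ≈T-sym t≈u j = sym (t≈u j)

  ≈T-trans : ∀ {t u v} → t ≈T u → u ≈T v → t ≈T v
  ≈T-trans t≈u u≈v j = trans (t≈u j) (u≈v j)

  -- Literals are compared by their tuples only, so that  Normal  is  Distinct  for this setoid.
  Literal-setoid : Setoid Level.zero Level.zero
  Literal-setoid = record
    { Carrier = Literal
    ; _≈_ = λ l l′ → proj₂ l ≈T proj₂ l′
    ; isEquivalence = record { refl = ≈T-refl ; sym = ≈T-sym ; trans = ≈T-trans } }

  Sources : Clause → Literal → Fin m → Set
  Sources L l w = Any (λ l′ → (proj₂ l′ ≈T proj₂ l) × (w ∈ₛ proj₁ l′)) L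

  ExactAt : Clause → Literal → Set
  ExactAt L l = Any (λ l′ → proj₂ l′ ≈T proj₂ l) L × (∀ w → (w ∈ₛ proj₁ l) ⇔ Sources L l w)

  MatchedIn : Clause → Literal → Set
  MatchedIn C r = Any (λ l → proj₂ l ≈T proj₂ r) C

  Exact : Clause → Clause → Set
  Exact D L = All (ExactAt L) D

  module Insert (x : Literal) where
    SameTuple : Literal → Set
    SameTuple y = proj₂ y ≈T proj₂ x

    merge : (D : Clause) → All (λ y → Dec (SameTuple y)) D → Clause
    merge []      []           = []
    merge (y ∷ D) (yes _ ∷ ds) = (proj₁ y ∪ proj₁ x , proj₂ y) ∷ merge D ds
    merge (y ∷ D) (no _  ∷ ds) = y ∷ merge D ds

    merge-tuples : ∀ D ds → map proj₂ (merge D ds) ≡ map proj₂ D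
    merge-tuples []      []           = refl
    merge-tuples (y ∷ D) (yes _ ∷ ds) = cong (proj₂ y ∷_) (merge-tuples D ds)
    merge-tuples (y ∷ D) (no _  ∷ ds) = cong (proj₂ y ∷_) (merge-tuples D ds)

    All-merge : ∀ {P : Tuple → Set} D ds → All (P ∘ proj₂) D → All (P ∘ proj₂) (merge D ds)
    All-merge {P} D ds = Allₚ.map⁻ ∘ subst (All P) (sym (merge-tuples D ds)) ∘ Allₚ.map⁺

    Any-merge : ∀ {P : Tuple → Set} D ds → Any (P ∘ proj₂) D → Any (P ∘ proj₂) (merge D ds)
    Any-merge {P} D ds = Anyₚ.map⁻ ∘ subst (Any P) (sym (merge-tuples D ds)) ∘ Anyₚ.map⁺

    Normal-merge : ∀ D ds → Normal D → Normal (merge D ds)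
    Normal-merge D ds =
      AllPairsₚ.map⁻ ∘ subst (AllPairs (λ t u → ¬ t ≈T u)) (sym (merge-tuples D ds)) ∘ AllPairsₚ.map⁺

    Exact-merge : ∀ {L} D ds → Exact D L → Exact (merge D ds) (x ∷ L)
    Exact-merge []      []            []                 = []
    Exact-merge (y ∷ D) (yes y≈x ∷ ds) ((y∈L , sets) ∷ ex) =
      (there y∈L , λ w → mk⇔ (to w) (from w)) ∷ Exact-merge D ds ex
      where
      to : ∀ w → w ∈ₛ proj₁ y ∪ proj₁ x → Sources (x ∷ _) y w
      to w w∈ with x∈p∪q⁻ (proj₁ y) (proj₁ x) w∈
      ... | inj₁ w∈y = there (Equivalence.to (sets w) w∈y)
      ... | inj₂ w∈x = here (≈T-sym y≈x , w∈x)
      from : ∀ w → Sources (x ∷ _) y w → w ∈ₛ proj₁ y ∪ proj₁ x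
      from w (here (_ , w∈x)) = x∈p∪q⁺ (inj₂ w∈x)
      from w (there w∈L)      = x∈p∪q⁺ (inj₁ (Equivalence.from (sets w) w∈L))
    Exact-merge (y ∷ D) (no y≉x ∷ ds) ((y∈L , sets) ∷ ex) =
      (there y∈L , λ w → mk⇔ (there ∘ Equivalence.to (sets w)) (from w)) ∷ Exact-merge D ds ex
      where
      from : ∀ w → Sources (x ∷ _) y w → w ∈ₛ proj₁ y
      from w (here (x≈y , _)) = ⊥-elim (y≉x (≈T-sym x≈y))
      from w (there w∈L)      = Equivalence.from (sets w) w∈L

    any-same : ∀ {D} → All (λ y → Dec (SameTuple y)) D → Dec (Any SameTuple D)
    any-same []           = no λ ()
    any-same (yes y≈x ∷ _) = yes (here y≈x)
    any-same (no y≉x ∷ ds) with any-same ds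
    ... | yes x∈D = yes (there x∈D)
    ... | no x∉D  = no λ { (here y≈x) → y≉x y≈x ; (there x∈D) → x∉D x∈D }

    insert : ∀ {L} D → Normalizes D L → All (λ y → Dec (SameTuple y)) D → ∃ λ D′ → Normalizes D′ (x ∷ L)
    insert D (D-normal , L⊆D , D-exact) ds with any-same ds
    ... | yes x∈D = merge D ds
                  , Normal-merge D ds D-normal
                  , Any-merge D ds (Any.map ≈T-sym x∈D) ∷ All.map (Any-merge D ds) L⊆D
                  , Exact-merge D ds D-exact
    ... | no x∉D  = x ∷ merge D ds
                  , All-merge D ds (¬Any⇒All¬ D (x∉D ∘ Any.map ≈T-sym)) ∷ Normal-merge D ds D-normal
                  , here ≈T-refl ∷ All.map (there ∘ Any-merge D ds) L⊆D
                  , (here ≈T-refl , λ w → mk⇔ (λ w∈x → here (≈T-refl , w∈x)) (from w))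
                    ∷ Exact-merge D ds D-exact
      where
      from : ∀ w → Sources (x ∷ _) x w → w ∈ₛ proj₁ x
      from w (here (_ , w∈x))      = w∈x
      from w (there l∈L) =
        let l∈D , l≈x , _ = All.lookupAny L⊆D l∈L
        in ⊥-elim (x∉D (Any.map (λ l≈y → ≈T-trans (≈T-sym l≈y) l≈x) l∈D))

  normalization-exists : ∀ L → DoubleNegation (∃ λ D → Normalizes D L)
  normalization-exists []      = pure ([] , [] , [] , [])
  normalization-exists (x ∷ L) = do
    (D , normalizes) ← normalization-exists L
    ds ← ¬¬-decide-all (Insert.SameTuple x) D
    pure (Insert.insert x D normalizes ds)

  -- Renaming apart

  evens odds : Renaming
  evens _ x = encode (inj₁ x)
  odds  _ x = encode (inj₂ x)

  evens-injective : Injective evens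
  evens-injective _ _ _ eq = inj₁-injective (encode-injective eq)

  odds-injective : Injective odds
  odds-injective _ _ _ eq = inj₂-injective (encode-injective eq)

  mutual
    occurs-renamed : ∀ ρ {s x s'} (t : Term s') → OccT s x (t [ ren ρ ]t) → ∃ λ y → x ≡ ρ s y
    occurs-renamed ρ (var y)    here       = y , refl
    occurs-renamed ρ (app f as) (inArgs o) = occursᵃ-renamed ρ as o

    occursᵃ-renamed : ∀ ρ {s x ss} (as : Args ss) → OccA s x (as [ ren ρ ]a) → ∃ λ y → x ≡ ρ s y
    occursᵃ-renamed ρ (t ∷ as) (hd o) = occurs-renamed ρ t o
    occursᵃ-renamed ρ (t ∷ as) (tl o) = occursᵃ-renamed ρ as o

  occursᶜ-renamed : ∀ ρ {s x} C → OccC s x (C [ ren ρ ]C) → ∃ λ y → x ≡ ρ s y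
  occursᶜ-renamed ρ (l ∷ C) (here (j , o)) = occurs-renamed ρ (proj₂ l j) o
  occursᶜ-renamed ρ (l ∷ C) (there o)      = occursᶜ-renamed ρ C o

  evens-odds-apart : ∀ C D → Apart (C [ ren evens ]C) (D [ ren odds ]C)
  evens-odds-apart C D s x x∈C x∈D with occursᶜ-renamed evens C x∈C | occursᶜ-renamed odds D x∈D
  ... | y , refl | z , eq with encode-injective {inj₁ y} {inj₂ z} eq
  ... | ()

  infixl 6 _⊕_
  _⊕_ : Subst → Subst → Subst
  (θ₁ ⊕ θ₂) s n = [ θ₁ s , θ₂ s ]′ (decode n)

  evens-⊕ : ∀ θ₁ θ₂ → ren evens ⨾ (θ₁ ⊕ θ₂) ≗ₛ θ₁
  evens-⊕ θ₁ θ₂ s x rewrite decode-encode (inj₁ x) = refl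

  odds-⊕ : ∀ θ₁ θ₂ → ren odds ⨾ (θ₁ ⊕ θ₂) ≗ₛ θ₂
  odds-⊕ θ₁ θ₂ s x rewrite decode-encode (inj₂ x) = refl

  []T-resp-≈ : ∀ θ {t u} → t ≈T u → (t [ θ ]T) ≈T (u [ θ ]T)
  []T-resp-≈ θ t≈u j = cong (_[ θ ]t) (t≈u j)

  []T-⨾≗ : ∀ {α β γ} → α ⨾ β ≗ₛ γ → ∀ t → ((t [ α ]T) [ β ]T) ≈T (t [ γ ]T)
  []T-⨾≗ {α} {β} α⨾β≗γ t j = trans ([]t-⨾ α β (t j)) ([]t-cong α⨾β≗γ (t j))

  -- Lifting

  infix 4 _≼_ _⊑_
  _≼_ : Literal → Literal → Set
  l ≼ l′ = proj₂ l ≈T proj₂ l′ × proj₁ l ⊆ₛ proj₁ l′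

  _⊑_ : Literal → Clause → Set
  l ⊑ D = Any (l ≼_) D

  _[_]⊑_ : Clause → Subst → Clause → Set
  C [ θ ]⊑ D = All (λ l → l [ θ ]L ⊑ D) C

  ≼-trans : ∀ {l l′ l″} → l ≼ l′ → l′ ≼ l″ → l ≼ l″
  ≼-trans (t≈t′ , A⊆A′) (t′≈t″ , A′⊆A″) = ≈T-trans t≈t′ t′≈t″ , A′⊆A″ ∘ A⊆A′

  ⊑-resp-≈ : ∀ {A t u D} → t ≈T u → (A , u) ⊑ D → (A , t) ⊑ D
  ⊑-resp-≈ t≈u = Any.map (≼-trans (t≈u , λ w∈A → w∈A))

  ⊑-trans : ∀ {l C D} → l ⊑ C → All (_⊑ D) C → l ⊑ D
  ⊑-trans l⊑C C⊑D = let c⊑D , l≼c = All.lookupAny C⊑D l⊑C in Any.map (≼-trans l≼c) c⊑D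

  ⊑-subst-⨾ : ∀ {l C} θ σ → l [ θ ]L ⊑ C → l [ θ ⨾ σ ]L ⊑ C [ σ ]C
  ⊑-subst-⨾ {l} θ σ = Anyₚ.map⁺ ∘ Any.map λ (t≈u , A⊆B) →
    ≈T-trans (≈T-sym ([]T-⨾≗ (λ _ _ → refl) (proj₂ l))) ([]T-resp-≈ σ t≈u) , A⊆B

  ⊑-refl : ∀ C → C [ idSubst ]⊑ C
  ⊑-refl C = All.tabulate λ {l} l∈C → lose l∈C ((λ j → []t-id (proj₂ l j)) , λ w∈A → w∈A)

  ⊑-at : ∀ {D l y} → Normal D → y ∈ D → l ⊑ D → proj₂ l ≈T proj₂ y → proj₁ l ⊆ₛ proj₁ y
  ⊑-at {l = l} D-normal y∈D l⊑D l≈y =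
    let y′ , y′∈D , l≈y′ , l⊆y′ = find l⊑D
        y′≡y = Distinct-∈-≈⇒≡ Literal-setoid D-normal y′∈D y∈D (≈T-trans (≈T-sym l≈y′) l≈y)
    in subst (λ z → proj₁ l ⊆ₛ proj₁ z) y′≡y l⊆y′

  ⊑-blatant : ∀ {l D} → l ⊑ D → BlatantlyInconsistent D → proj₁ l ≡ ∅
  ⊑-blatant l⊑D D-blatant =
    let y , y∈D , _ , l⊆y = find l⊑D
    in ⊆-antisym (λ w∈l → subst (_ ∈ₛ_) (All.lookup D-blatant y∈D) (l⊆y w∈l)) ⊥⊆

  Normalizes⇒⊑ : ∀ {D L} → Normalizes D L → All (_⊑ D) L
  Normalizes⇒⊑ (_ , L⊆D , D-exact) = All.tabulate λ {l} l∈L →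
    let y , y∈D , l≈y = find (All.lookup L⊆D l∈L)
    in lose y∈D (l≈y , λ {w} w∈l → Equivalence.from (proj₂ (All.lookup D-exact y∈D) w) (lose l∈L (l≈y , w∈l)))

  ⋃-upper : ∀ {a} As → a ∈ As → proj₁ a ⊆ₛ ⋃ As
  ⋃-upper (a ∷ As) (here refl) w∈a = x∈p∪q⁺ (inj₁ w∈a)
  ⋃-upper (_ ∷ As) (there a∈As) w∈a = x∈p∪q⁺ (inj₂ (⋃-upper As a∈As w∈a))

  ⋃-least : ∀ {Z} As → All (λ a → proj₁ a ⊆ₛ Z) As → ⋃ As ⊆ₛ Z
  ⋃-least []       []              w∈⋃ = ⊥-elim (∉⊥ w∈⋃)
  ⋃-least (a ∷ As) (a⊆Z ∷ As⊆Z) w∈⋃ with x∈p∪q⁻ (proj₁ a) (⋃ As) w∈⋃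
  ... | inj₁ w∈a  = a⊆Z w∈a
  ... | inj₂ w∈As = ⋃-least As As⊆Z w∈As

  []T-via : ∀ {α σ θ τ θ₀} → τ ≗ₛ σ ⨾ θ → α ⨾ τ ≗ₛ θ₀ → ∀ t → (((t [ α ]T) [ σ ]T) [ θ ]T) ≈T (t [ θ₀ ]T)
  []T-via {α} {σ} {θ} {τ} τ≗σ⨾θ α⨾τ≗θ₀ t =
    ≈T-trans ([]T-⨾≗ {σ} {θ} {τ} (λ s x → sym (τ≗σ⨾θ s x)) (t [ α ]T)) ([]T-⨾≗ {α} {τ} α⨾τ≗θ₀ t)

  module Lifting (φ : List Clause) where

    Liftable : Clause → Set
    Liftable D′ = ∃₂ λ D θ → Derives SR φ D × D [ θ ]⊑ D′

    -- y₀ is the literal of D′ into which the resolved literal of an (lSR) step was merged.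
    module Target (D′ : Clause) (D′-normal : Normal D′) (y₀ : Literal) (y₀∈D′ : y₀ ∈ D′)
                  (Z : Subset m) (y₀⊆Z : proj₁ y₀ ⊆ₛ Z) where

      Pending : Subst → Literal → Set
      Pending θ l = l [ θ ]L ≼ (Z , proj₂ y₀)

      -- The pending literals of R have distinct tuples, each of which is the tuple of a literal of P.
      split-normalized : ∀ θ {R K P} → Normalizes R (K ++ P) → K [ θ ]⊑ D′ → All (Pending θ) P →
                         DoubleNegation (Σ (Split (λ l → l [ θ ]L ⊑ D′) (λ l → Pending θ l × MatchedIn P l) R)
                                           λ s → length (Split.right s) ≤ length P)
      split-normalized θ {R} {K} {P} (R-normal , _ , R-exact) K⊑D′ P-pending = do
        classified ← All.mapM _ ¬¬-Monad classify R-exact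
        let s = split classified
        pure (s , Distinct-length-≤ Literal-setoid (AllPairs-resp-⊇ (Split.right-⊆ s) R-normal)
                                                  (All.map proj₂ (Split.all-right s)))
        where
        source : ∀ {r w} → ExactAt (K ++ P) r → w ∈ₛ proj₁ r → Sources K r w ⊎ Sources P r w
        source {w = w} (_ , sets) w∈r = Anyₚ.++⁻ K (Equivalence.to (sets w) w∈r)

        kept-in : ∀ {r y} → y ∈ D′ → proj₂ (r [ θ ]L) ≈T proj₂ y → ∀ {l} → l ∈ K → proj₂ l ≈T proj₂ r →
                  proj₁ l ⊆ₛ proj₁ y
        kept-in y∈D′ r≈y l∈K l≈r =
          ⊑-at D′-normal y∈D′ (All.lookup K⊑D′ l∈K) (≈T-trans ([]T-resp-≈ θ l≈r) r≈y)

        pending : ∀ {r} → MatchedIn P r → ExactAt (K ++ P) r → Pending θ r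
        pending {r} r∈P exact = r≈y₀ , λ w∈r → case-source (source exact w∈r)
          where
          r≈y₀ : proj₂ (r [ θ ]L) ≈T proj₂ y₀
          r≈y₀ = let p , p∈P , p≈r = find r∈P
                 in ≈T-trans ([]T-resp-≈ θ (≈T-sym p≈r)) (proj₁ (All.lookup P-pending p∈P))
          case-source : ∀ {w} → Sources K r w ⊎ Sources P r w → w ∈ₛ Z
          case-source (inj₁ w∈K) =
            let l , l∈K , l≈r , w∈l = find w∈K in y₀⊆Z (kept-in {r} y₀∈D′ r≈y₀ l∈K l≈r w∈l)
          case-source (inj₂ w∈P) = let l , l∈P , _ , w∈l = find w∈P in proj₂ (All.lookup P-pending l∈P) w∈l

        kept : ∀ {r} → ¬ MatchedIn P r → ExactAt (K ++ P) r → r [ θ ]L ⊑ D′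
        kept {r} r∉P exact@(r∈L , _) with Anyₚ.++⁻ K r∈L
        ... | inj₂ r∈P = ⊥-elim (r∉P r∈P)
        ... | inj₁ r∈K =
          let l₀ , l₀∈K , l₀≈r = find r∈K
              y , y∈D′ , l₀≈y , _ = find (All.lookup K⊑D′ l₀∈K)
              r≈y = ≈T-trans ([]T-resp-≈ θ (≈T-sym l₀≈r)) l₀≈y
          in lose y∈D′ (r≈y , λ w∈r → case-source y∈D′ r≈y (source exact w∈r))
          where
          case-source : ∀ {y w} → y ∈ D′ → proj₂ (r [ θ ]L) ≈T proj₂ y → Sources K r w ⊎ Sources P r w →
                        w ∈ₛ proj₁ y
          case-source y∈D′ r≈y (inj₁ w∈K) =
            let l , l∈K , l≈r , w∈l = find w∈K in kept-in {r} y∈D′ r≈y l∈K l≈r w∈l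
          case-source y∈D′ r≈y (inj₂ w∈P) = ⊥-elim (r∉P (Any.map proj₁ w∈P))

        classify : ∀ {r} → ExactAt (K ++ P) r → DoubleNegation (r [ θ ]L ⊑ D′ ⊎ (Pending θ r × MatchedIn P r))
        classify {r} exact = do
          matched? ← ¬¬-excluded-middle
          pure (case matched? of λ where
            (yes r∈P) → inj₂ (pending r∈P exact , r∈P)
            (no r∉P)  → inj₁ (kept r∉P exact))

      -- U is the union of the sets of the resolved literals; the literals A₁ of the first lifted premise
      -- lie under it, and are resolved against one pending literal at a time.
      module Iteration (U : Subset m) (U∩Z⊆y₀ : U ∩ Z ⊆ₛ proj₁ y₀)
                       {D₁ θ₁} (d₁ : Derives SR φ D₁) (K₁ A₁ : Clause) (D₁↭ : D₁ ↭ K₁ ++ A₁)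
                       (A₁≢[] : ¬ A₁ ≡ [])
                       (K₁⊑D′ : K₁ [ θ₁ ]⊑ D′) (A₁≼ : All (λ l → l [ θ₁ ]L ≼ (U , proj₂ y₀)) A₁) where

        module Resolvent {R θR} (d : Derives SR φ R) (K : Clause) (p : Literal) (P : Clause)
                         (R↭ : R ↭ K ++ p ∷ P) (p-pending : Pending θR p) where
          open ≡-Reasoning

          evensL oddsL : Literal → Literal
          evensL = _[ ren evens ]L
          oddsL = _[ ren odds ]L

          Γ As Δ : Clause
          Γ  = map evensL K₁
          As = map evensL A₁
          Δ  = map oddsL (K ++ P)

          u : Tuple
          u = proj₂ (oddsL p)

          τ : Subst
          τ = θ₁ ⊕ θR

          τ-unifies : Unifies τ (map proj₂ As) u
          τ-unifies = Allₚ.map⁺ (Allₚ.map⁺ (All.map (λ {a} (a≈y₀ , _) →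
            ≈T-trans ([]T-⨾≗ (evens-⊕ θ₁ θR) (proj₂ a))
              (≈T-trans a≈y₀ (≈T-sym (≈T-trans ([]T-⨾≗ (odds-⊕ θ₁ θR) (proj₂ p)) (proj₁ p-pending))))) A₁≼))

          mgu : ∃ λ σ → MGU σ (map proj₂ As) u
          mgu = unifiable⇒mgu τ (map proj₂ As) u τ-unifies

          σ θ : Subst
          σ = proj₁ mgu
          θ = proj₁ (proj₂ (proj₂ mgu) τ τ-unifies)

          τ≗σ⨾θ : τ ≗ₛ σ ⨾ θ
          τ≗σ⨾θ = proj₂ (proj₂ (proj₂ mgu) τ τ-unifies)

          via-evens : ∀ t → (((t [ ren evens ]T) [ σ ]T) [ θ ]T) ≈T (t [ θ₁ ]T)
          via-evens = []T-via τ≗σ⨾θ (evens-⊕ θ₁ θR)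

          via-odds : ∀ t → (((t [ ren odds ]T) [ σ ]T) [ θ ]T) ≈T (t [ θR ]T)
          via-odds = []T-via τ≗σ⨾θ (odds-⊕ θ₁ θR)

          resolved : Literal
          resolved = ⋃ As ∩ proj₁ p , u [ σ ]T

          resolvent : Clause
          resolvent = (Γ [ σ ]C) ++ resolved ∷ (Δ [ σ ]C)

          derives : ∀ {R′} → Normalizes R′ resolvent → Derives SR φ R′
          derives = step evens odds Γ As (proj₁ p) u Δ σ _ d₁ d evens-injective odds-injective
                         (evens-odds-apart D₁ R) ↭₁ (A₁≢[] ∘ map≡[]⇒≡[] A₁) ↭₂ (proj₂ mgu)
            where
            ↭₁ : map evensL D₁ ↭ Γ ++ As
            ↭₁ = ↭-trans (Permₚ.map⁺ evensL D₁↭) (↭-reflexive (map-++ evensL K₁ A₁))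
            ↭₂ : map oddsL R ↭ oddsL p ∷ Δ
            ↭₂ = ↭-trans (Permₚ.map⁺ oddsL R↭) (↭-trans (↭-reflexive (map-++ oddsL K (p ∷ P)))
                   (↭-trans (shift (oddsL p) (map oddsL K) (map oddsL P))
                            (↭-reflexive (cong (oddsL p ∷_) (sym (map-++ oddsL K P))))))

          kept pending : Clause
          kept    = (Γ [ σ ]C) ++ resolved ∷ (map oddsL K [ σ ]C)
          pending = map oddsL P [ σ ]C

          resolvent≡ : resolvent ≡ kept ++ pending
          resolvent≡ = begin
            (Γ [ σ ]C) ++ resolved ∷ (Δ [ σ ]C)
              ≡⟨ cong (λ z → (Γ [ σ ]C) ++ resolved ∷ z)
                      (trans (cong (_[ σ ]C) (map-++ oddsL K P)) (map-++ _ (map oddsL K) (map oddsL P))) ⟩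
            (Γ [ σ ]C) ++ resolved ∷ (map oddsL K [ σ ]C) ++ pending
              ≡⟨ ++-assoc (Γ [ σ ]C) (resolved ∷ (map oddsL K [ σ ]C)) pending ⟨
            kept ++ pending ∎

          resolved⊑D′ : resolved [ θ ]L ⊑ D′
          resolved⊑D′ = lose y₀∈D′ (≈T-trans (via-odds (proj₂ p)) (proj₁ p-pending) , ⋃As∩p⊆y₀)
            where
            ⋃As∩p⊆y₀ : ⋃ As ∩ proj₁ p ⊆ₛ proj₁ y₀
            ⋃As∩p⊆y₀ w∈ = let w∈⋃As , w∈p = x∈p∩q⁻ (⋃ As) (proj₁ p) w∈ in
              U∩Z⊆y₀ (x∈p∩q⁺ (⋃-least As (Allₚ.map⁺ (All.map proj₂ A₁≼)) w∈⋃As , proj₂ p-pending w∈p))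

          kept⊑D′ : K [ θR ]⊑ D′ → kept [ θ ]⊑ D′
          kept⊑D′ K⊑D′ =
            Allₚ.++⁺ (Allₚ.map⁺ (Allₚ.map⁺ (All.map (λ {q} → ⊑-resp-≈ (via-evens (proj₂ q))) K₁⊑D′)))
                     (resolved⊑D′
                      ∷ Allₚ.map⁺ (Allₚ.map⁺ (All.map (λ {q} → ⊑-resp-≈ (via-odds (proj₂ q))) K⊑D′)))

          pending-pending : All (Pending θR) P → All (Pending θ) pending
          pending-pending = Allₚ.map⁺ ∘ Allₚ.map⁺ ∘ All.map (λ {q} (q≈y₀ , q⊆Z) →
            ≈T-trans (via-odds (proj₂ q)) q≈y₀ , q⊆Z)

          length-pending : length pending ≡ length P
          length-pending = trans (length-map _ (map oddsL P)) (length-map oddsL P)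

        iterate : ∀ n {R θ} → Derives SR φ R → ∀ K P → R ↭ K ++ P → K [ θ ]⊑ D′ → All (Pending θ) P →
                  length P ≤ n → DoubleNegation (Liftable D′)
        iterate _ {R} {θ} d K [] R↭ K⊑D′ _ _ =
          pure (R , θ , d , Permₚ.All-resp-↭ (↭-sym R↭) (Allₚ.++⁺ K⊑D′ []))
        iterate (suc n) d K (p ∷ P) R↭ K⊑D′ (p-pending ∷ P-pending) (s≤s |P|≤n) = do
          (R′ , normalizes) ← normalization-exists resolvent
          (s , |P′|≤) ← split-normalized θ (subst (Normalizes R′) resolvent≡ normalizes) (kept⊑D′ K⊑D′)
                                        (pending-pending P-pending)
          iterate n (derives normalizes) (Split.left s) (Split.right s) (Split.↭-split s) (Split.all-left s)
                  (All.map proj₁ (Split.all-right s))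
                  (≤-trans |P′|≤ (≤-trans (≤-reflexive length-pending) |P|≤n))
          where open Resolvent d K p P R↭ p-pending

    lift-step : ∀ {C₁ C₂ D′} ρ₁ ρ₂ Γ As B u Δ σ →
                C₁ [ ren ρ₁ ]C ↭ Γ ++ As → C₂ [ ren ρ₂ ]C ↭ (B , u) ∷ Δ → Unifies σ (map proj₂ As) u →
                Normalizes D′ ((Γ [ σ ]C) ++ (⋃ As ∩ B , u [ σ ]T) ∷ (Δ [ σ ]C)) →
                Liftable C₁ → Liftable C₂ → DoubleNegation (Liftable D′)
    lift-step {C₁} {C₂} {D′} ρ₁ ρ₂ Γ As B u Δ σ C₁↭ C₂↭ σ-unifies normalizes
              (D₁ , θ₁ , d₁ , D₁⊑C₁) (D₂ , θ₂ , d₂ , D₂⊑C₂) =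
      let s₁ = split (All.map (λ {l} → classify₁ {l}) D₁⊑C₁)
      in continue (Split.left s₁) (Split.right s₁) (Split.↭-split s₁) (Split.all-left s₁) (Split.all-right s₁)
      where
      L′⊑D′ : All (_⊑ D′) ((Γ [ σ ]C) ++ (⋃ As ∩ B , u [ σ ]T) ∷ (Δ [ σ ]C))
      L′⊑D′ = Normalizes⇒⊑ normalizes

      resolved⊑D′ : (⋃ As ∩ B , u [ σ ]T) ⊑ D′
      resolved⊑D′ = All.lookup L′⊑D′ (∈-++⁺ʳ (Γ [ σ ]C) (here refl))

      y₀ : Literal
      y₀ = proj₁ (find resolved⊑D′)

      y₀∈D′ : y₀ ∈ D′
      y₀∈D′ = proj₁ (proj₂ (find resolved⊑D′))

      û≈y₀ : (u [ σ ]T) ≈T proj₂ y₀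
      û≈y₀ = proj₁ (proj₂ (proj₂ (find resolved⊑D′)))

      ⋃As∩B⊆y₀ : ⋃ As ∩ B ⊆ₛ proj₁ y₀
      ⋃As∩B⊆y₀ = proj₂ (proj₂ (proj₂ (find resolved⊑D′)))

      -- Pending literals of the second premise start inside B; merging them with kept literals at the
      -- tuple of y₀ can only add elements of y₀.
      Z : Subset m
      Z = B ∪ proj₁ y₀

      ⋃As∩Z⊆y₀ : ⋃ As ∩ Z ⊆ₛ proj₁ y₀
      ⋃As∩Z⊆y₀ w∈ with x∈p∩q⁻ (⋃ As) Z w∈
      ... | w∈⋃As , w∈Z with x∈p∪q⁻ B (proj₁ y₀) w∈Z
      ...   | inj₁ w∈B  = ⋃As∩B⊆y₀ (x∈p∩q⁺ (w∈⋃As , w∈B))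
      ...   | inj₂ w∈y₀ = w∈y₀

      ⊑-premise : ∀ l {C X} θ ρ → l [ θ ]L ⊑ C → C [ ren ρ ]C ↭ X → l [ θ ⨾ ren ρ ⨾ σ ]L ⊑ X [ σ ]C
      ⊑-premise l θ ρ l⊑C C↭X =
        Permₚ.Any-resp-↭ (Permₚ.map⁺ _ C↭X) (⊑-subst-⨾ {l} (θ ⨾ ren ρ) σ (⊑-subst-⨾ {l} θ (ren ρ) l⊑C))

      θ₁* θ₂* : Subst
      θ₁* = θ₁ ⨾ ren ρ₁ ⨾ σ
      θ₂* = θ₂ ⨾ ren ρ₂ ⨾ σ

      classify₁ : ∀ {l} → l [ θ₁ ]L ⊑ C₁ → l [ θ₁* ]L ⊑ D′ ⊎ l [ θ₁* ]L ≼ (⋃ As , proj₂ y₀)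
      classify₁ {l} l⊑C₁ with Anyₚ.++⁻ Γ (Anyₚ.map⁻ (⊑-premise l θ₁ ρ₁ l⊑C₁ C₁↭))
      ... | inj₁ l⊑Γσ  = inj₁ (⊑-trans (Anyₚ.map⁺ l⊑Γσ) (Allₚ.++⁻ˡ (Γ [ σ ]C) L′⊑D′))
      ... | inj₂ l⊑Asσ = let a , a∈As , l≈a , l⊆a = find l⊑Asσ in
        inj₂ ( ≈T-trans l≈a (≈T-trans (All.lookup σ-unifies (∈-map⁺ proj₂ a∈As)) û≈y₀)
             , ⋃-upper As a∈As ∘ l⊆a )

      classify₂ : ∀ {l} → l [ θ₂ ]L ⊑ C₂ → l [ θ₂* ]L ⊑ D′ ⊎ l [ θ₂* ]L ≼ (Z , proj₂ y₀)
      classify₂ {l} l⊑C₂ with ⊑-premise l θ₂ ρ₂ l⊑C₂ C₂↭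
      ... | here (l≈û , l⊆B) = inj₂ (≈T-trans l≈û û≈y₀ , x∈p∪q⁺ ∘ inj₁ ∘ l⊆B)
      ... | there l⊑Δσ       = inj₁ (⊑-trans l⊑Δσ (All.tail (Allₚ.++⁻ʳ (Γ [ σ ]C) L′⊑D′)))

      continue : ∀ K₁ A₁ → D₁ ↭ K₁ ++ A₁ → K₁ [ θ₁* ]⊑ D′ →
                 All (λ l → l [ θ₁* ]L ≼ (⋃ As , proj₂ y₀)) A₁ → DoubleNegation (Liftable D′)
      continue K₁ [] D₁↭ K₁⊑D′ _ = pure (D₁ , θ₁* , d₁ , Permₚ.All-resp-↭ (↭-sym D₁↭) (Allₚ.++⁺ K₁⊑D′ []))
      continue K₁ A₁@(_ ∷ _) D₁↭ K₁⊑D′ A₁≼ =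
        let s₂ = split (All.map (λ {l} → classify₂ {l}) D₂⊑C₂)
        in Iteration.iterate (⋃ As) ⋃As∩Z⊆y₀ d₁ K₁ A₁ D₁↭ (λ ()) K₁⊑D′ A₁≼
             (length (Split.right s₂)) d₂ (Split.left s₂) (Split.right s₂) (Split.↭-split s₂)
             (Split.all-left s₂) (Split.all-right s₂) ≤-refl
        where open Target D′ (proj₁ normalizes) y₀ y₀∈D′ Z (x∈p∪q⁺ ∘ inj₂)

    lift : ∀ {D′} → Derives lSR φ D′ → DoubleNegation (Liftable D′)
    lift {C} (axiom C∈φ) = pure (C , idSubst , axiom C∈φ , ⊑-refl C)
    lift (step ρ₁ ρ₂ Γ As B u Δ σ _ d₁ d₂ _ _ _ C₁↭ _ C₂↭ σ-unifies normalizes) = do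
      lifted₁ ← lift d₁
      lifted₂ ← lift d₂
      lift-step ρ₁ ρ₂ Γ As B u Δ σ C₁↭ C₂↭ σ-unifies normalizes lifted₁ lifted₂

    SR-consistent⇒lSR-consistent : Consistent SR φ → Consistent lSR φ
    SR-consistent⇒lSR-consistent consistent (D′ , d′ , D′-blatant) =
      lift d′ λ (D , θ , d , D⊑D′) →
        consistent (D , d , All.map (λ l⊑D′ → ⊑-blatant l⊑D′ D′-blatant) D⊑D′)

lemma13 : (k m : ℕ) (S : Signature k) (φ : List (Logic.Clause k m S)) →
          All (Logic.Normal k m S) φ →
          Logic.Consistent k m S SR φ →
          Logic.Consistent k m S lSR φ
lemma13 k m S φ _ = Resolution.Lifting.SR-consistent⇒lSR-consistent k m S φ
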